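{- Let $(g,f_1,f_2)$ be a Sprugnoli array with matrix $(t_{n,k})$. Then the row sums have generating function $$\sum_{n\ge0}\Big(\sum_{k\ge0}t_{n,k}\Big)x^n=\frac{g(x)(1+f_1(x))}{1-xf_2(x)}.$$
   Context: All power series are formal power series over a field $\mathbb{K}$ of characteristic $0$. $\mathcal{F}_r$ denotes the set of power series $\sum_{n\ge r}a_nx^n$ with $a_r\ne0$. A Sprugnoli array is a triple $(g,f_1,f_2)$ with $g\in\mathcal{F}_0$, $f_1\in\mathcal{F}_1$, $f_2\in\mathcal{F}_1$ and $f_2$ odd (only odd powers of $x$); its matrix is the lower-triangular matrix $(t_{n,k})_{n,k\ge0}$ with $t_{n,k}=[x^n]\,g(x)f_1(x)^{k\bmod 2}(xf_2(x))^{\lfloor k/2\rfloor}$. -}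

module Defs where

open import Level using (Level; _⊔_)
open import Algebra.Bundles using (CommutativeRing)
open import Data.Nat as ℕ using (ℕ; zero; suc; _∸_; _<_; _%_; _/_)
open import Data.List using (List; []; _∷_; foldr; zipWith; upTo; map)
open import Data.Product using (_×_; ∃)
open import Relation.Nullary using (¬_)

module PS {c ℓ : Level} (R : CommutativeRing c ℓ) where
  open CommutativeRing R

  IsField : Set (c ⊔ ℓ)
  IsField = (¬ (1# ≈ 0#)) × (∀ a → ¬ (a ≈ 0#) → ∃ λ b → a * b ≈ 1#)

  fromℕ : ℕ → Carrier
  fromℕ zero = 0#
  fromℕ (suc n) = 1# + fromℕ n

  CharZero : Set ℓ
  CharZero = ∀ n → ¬ (fromℕ (suc n) ≈ 0#)

  Series : Set c
  Series = ℕ → Carrier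

  _≋_ : Series → Series → Set ℓ
  f ≋ g = ∀ n → f n ≈ g n

  sumBelow : ℕ → (ℕ → Carrier) → Carrier
  sumBelow zero a = 0#
  sumBelow (suc n) a = sumBelow n a + a n

  zeroS : Series
  zeroS _ = 0#

  oneS : Series
  oneS zero = 1#
  oneS (suc _) = 0#

  _⊕_ : Series → Series → Series
  (f ⊕ g) n = f n + g n

  _⊖_ : Series → Series → Series
  (f ⊖ g) n = f n - g n

  _⊛_ : Series → Series → Series
  (f ⊛ g) n = sumBelow (suc n) (λ i → f i * g (n ∸ i))

  _^ˢ_ : Series → ℕ → Series
  f ^ˢ zero = oneS
  f ^ˢ suc k = f ⊛ (f ^ˢ k)

  xS : Series → Series
  (xS f) zero = 0#
  (xS f) (suc n) = f n

  -- Reciprocal 1/u of a series u with constant term 1: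
  -- b 0 = 1,  b (n+1) = - Σ_{i=1}^{n+1} u i * b (n+1-i).
  -- recipList u n = [b n, b (n-1), ..., b 0].
  private
    sumList : List Carrier → Carrier
    sumList = foldr _+_ 0#

  recipList : Series → ℕ → List Carrier
  recipList u zero = 1# ∷ []
  recipList u (suc n) =
    let bs = recipList u n in
    (- sumList (zipWith _*_ (map (λ m → u (suc m)) (upTo (suc n))) bs)) ∷ bs

  headOr0 : List Carrier → Carrier
  headOr0 [] = 0#
  headOr0 (b ∷ _) = b

  recip₁ : Series → Series
  recip₁ u n = headOr0 (recipList u n)

  In𝓕 : ℕ → Series → Set ℓ
  In𝓕 r f = (∀ n → n < r → f n ≈ 0#) × ¬ (f r ≈ 0#)

  Odd : Series → Set ℓ
  Odd f = ∀ m → f (2 ℕ.* m) ≈ 0#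

  IsSprugnoliArray : Series → Series → Series → Set ℓ
  IsSprugnoliArray g f₁ f₂ = In𝓕 0 g × In𝓕 1 f₁ × In𝓕 1 f₂ × Odd f₂

  entry : Series → Series → Series → ℕ → ℕ → Carrier
  entry g f₁ f₂ n k = ((g ⊛ (f₁ ^ˢ (k % 2))) ⊛ (xS f₂ ^ˢ (k / 2))) n

  -- row sum Σ_{k ≥ 0} t_{n,k} = Σ_{k=0}^{n} t_{n,k}  (t is lower triangular)
  rowSum : Series → Series → Series → Series
  rowSum g f₁ f₂ n = sumBelow (suc n) (entry g f₁ f₂ n)

-- Grouping the columns in pairs (2j, 2j+1), the two entries of column pair j
-- add up to [xⁿ] g (1 + f₁) (x f₂)ʲ.  Since f₁ and x f₂ have order at least 1
-- and 2, the matrix is lower triangular, so the n-th row sum is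
-- [xⁿ] g (1 + f₁) Σ_{j ≤ n} (x f₂)ʲ, and the truncated geometric series agrees
-- with 1/(1 - x f₂) up to degree n.  Finally recip₁ is identified with the
-- geometric series through the recurrence that defines it.
module Submission where

open import Defs
open import Level using (Level)
open import Algebra.Bundles using (CommutativeRing)
open import Data.Nat as ℕ
  using (ℕ; zero; suc; _∸_; _%_; _/_; _≤′_; ≤′-reflexive; ≤′-step; z≤n; s≤s)
import Data.Nat.Properties as ℕP
open import Data.Nat.DivMod using (m≡m%n+[m/n]*n; m/n≡1+[m∸n]/n)
open import Data.List using (List; []; _∷_; foldr; zipWith; map; upTo; applyUpTo; applyDownFrom)
open import Data.List.Properties using (map-applyUpTo)
open import Data.List.Relation.Binary.Pointwise using (Pointwise; []; _∷_)
open import Data.Product using (_,_)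
open import Relation.Nullary using (yes; no)
import Relation.Binary.PropositionalEquality as Eq

module SeriesAlgebra {c ℓ : Level} (R : CommutativeRing c ℓ) where
  open CommutativeRing R hiding (zero)
  open PS R
  open import Algebra.Properties.Ring ring using (-‿distribˡ-*; -‿involutive; -‿+-comm; -0#≈0#)
  open import Algebra.Properties.CommutativeSemigroup +-commutativeSemigroup using (interchange)
  open import Relation.Binary.Reasoning.Setoid setoid

  sumBelow-cong : ∀ n {a b : ℕ → Carrier} → (∀ i → i ℕ.< n → a i ≈ b i) →
                  sumBelow n a ≈ sumBelow n b
  sumBelow-cong zero    a≈b = refl
  sumBelow-cong (suc n) a≈b =
    +-cong (sumBelow-cong n (λ i i<n → a≈b i (ℕP.m<n⇒m<1+n i<n))) (a≈b n (ℕP.n<1+n n))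

  sumBelow-zero : ∀ n {a : ℕ → Carrier} → (∀ i → i ℕ.< n → a i ≈ 0#) → sumBelow n a ≈ 0#
  sumBelow-zero n a≈0 = trans (sumBelow-cong n a≈0) (sumBelow-zero′ n)
    where
    sumBelow-zero′ : ∀ n → sumBelow n (λ _ → 0#) ≈ 0#
    sumBelow-zero′ zero    = refl
    sumBelow-zero′ (suc n) = trans (+-identityʳ _) (sumBelow-zero′ n)

  sumBelow-+ : ∀ n (a b : ℕ → Carrier) →
               sumBelow n (λ i → a i + b i) ≈ sumBelow n a + sumBelow n b
  sumBelow-+ zero    a b = sym (+-identityˡ 0#)
  sumBelow-+ (suc n) a b =
    trans (+-cong (sumBelow-+ n a b) refl) (interchange (sumBelow n a) (sumBelow n b) (a n) (b n))

  -‿sumBelow : ∀ n (a : ℕ → Carrier) → - sumBelow n a ≈ sumBelow n (λ i → - a i)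
  -‿sumBelow zero    a = -0#≈0#
  -‿sumBelow (suc n) a = trans (sym (-‿+-comm (sumBelow n a) (a n))) (+-cong (-‿sumBelow n a) refl)

  sumBelow-suc : ∀ n (a : ℕ → Carrier) → sumBelow (suc n) a ≈ a 0 + sumBelow n (λ i → a (suc i))
  sumBelow-suc zero    a = +-comm 0# (a 0)
  sumBelow-suc (suc n) a = trans (+-cong (sumBelow-suc n a) refl) (+-assoc (a 0) _ _)

  sumBelow-truncate : ∀ {m N} (a : ℕ → Carrier) → m ≤′ N → (∀ k → m ℕ.≤ k → a k ≈ 0#) →
                      sumBelow N a ≈ sumBelow m a
  sumBelow-truncate a (≤′-reflexive Eq.refl) a≈0 = refl
  sumBelow-truncate {m} {suc N} a (≤′-step m≤′N) a≈0 =
    trans (+-cong (sumBelow-truncate a m≤′N a≈0) (a≈0 N (ℕP.≤′⇒≤ m≤′N))) (+-identityʳ _)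

  double : ℕ → ℕ
  double zero    = zero
  double (suc n) = suc (suc (double n))

  n≤double : ∀ n → n ℕ.≤ double n
  n≤double zero    = z≤n
  n≤double (suc n) = s≤s (ℕP.m≤n⇒m≤1+n (n≤double n))

  sumBelow-pairs : ∀ N (a : ℕ → Carrier) →
                   sumBelow (double N) a ≈ sumBelow N (λ j → a (double j) + a (suc (double j)))
  sumBelow-pairs zero    a = refl
  sumBelow-pairs (suc N) a = trans (+-assoc (sumBelow (double N) a) _ _) (+-cong (sumBelow-pairs N a) refl)

  ⊛-congˡ : ∀ {A A′} B → A ≋ A′ → (A ⊛ B) ≋ (A′ ⊛ B)
  ⊛-congˡ B A≋A′ n = sumBelow-cong (suc n) (λ i _ → *-cong (A≋A′ i) refl)

  ⊛-congʳ-≤ : ∀ A {B B′} n → (∀ m → m ℕ.≤ n → B m ≈ B′ m) → (A ⊛ B) n ≈ (A ⊛ B′) n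
  ⊛-congʳ-≤ A n B≈B′ = sumBelow-cong (suc n) (λ i _ → *-cong refl (B≈B′ (n ∸ i) (ℕP.m∸n≤m n i)))

  ⊛-distribˡ : ∀ A B C → (A ⊛ (B ⊕ C)) ≋ ((A ⊛ B) ⊕ (A ⊛ C))
  ⊛-distribˡ A B C n =
    trans (sumBelow-cong (suc n) (λ i _ → distribˡ (A i) (B (n ∸ i)) (C (n ∸ i)))) (sumBelow-+ (suc n) _ _)

  ⊛-distribʳ : ∀ A B C → ((A ⊕ B) ⊛ C) ≋ ((A ⊛ C) ⊕ (B ⊛ C))
  ⊛-distribʳ A B C n =
    trans (sumBelow-cong (suc n) (λ i _ → distribʳ (C (n ∸ i)) (A i) (B i))) (sumBelow-+ (suc n) _ _)

  ⊛-identityʳ : ∀ A → (A ⊛ oneS) ≋ A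
  ⊛-identityʳ A n = begin
    sumBelow n (λ i → A i * oneS (n ∸ i)) + A n * oneS (n ∸ n)
      ≈⟨ +-cong (sumBelow-zero n (λ i i<n → trans (*-cong refl (oneS-pos (ℕP.m<n⇒0<n∸m i<n))) (zeroʳ _)))
                (trans (*-cong refl (reflexive (Eq.cong oneS (ℕP.n∸n≡0 n)))) (*-identityʳ _)) ⟩
    0# + A n ≈⟨ +-identityˡ _ ⟩
    A n ∎
    where
    oneS-pos : ∀ {m} → 0 ℕ.< m → oneS m ≈ 0#
    oneS-pos {suc m} _ = refl

  ⊛-sumBelowʳ : ∀ A (F : ℕ → Series) N n →
                (A ⊛ (λ m → sumBelow N (λ j → F j m))) n ≈ sumBelow N (λ j → (A ⊛ F j) n)
  ⊛-sumBelowʳ A F zero    n = sumBelow-zero (suc n) (λ i _ → zeroʳ _)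
  ⊛-sumBelowʳ A F (suc N) n =
    trans (⊛-distribˡ A (λ m → sumBelow N (λ j → F j m)) (F N) n) (+-cong (⊛-sumBelowʳ A F N n) refl)

  OrderAtLeast : ℕ → Series → Set ℓ
  OrderAtLeast a X = ∀ n → n ℕ.< a → X n ≈ 0#

  ⊛-orderAtLeast : ∀ {a b A B} → OrderAtLeast a A → OrderAtLeast b B → OrderAtLeast (a ℕ.+ b) (A ⊛ B)
  ⊛-orderAtLeast {a} {b} {A} {B} ordA ordB n n<a+b = sumBelow-zero (suc n) term≈0
    where
    term≈0 : ∀ i → i ℕ.< suc n → A i * B (n ∸ i) ≈ 0#
    term≈0 i (s≤s i≤n) with i ℕ.<? a
    ... | yes i<a = trans (*-cong (ordA i i<a) refl) (zeroˡ _)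
    ... | no  i≮a = trans (*-cong refl (ordB (n ∸ i) n∸i<b)) (zeroʳ _)
      where
      n∸i<b : n ∸ i ℕ.< b
      n∸i<b = ℕP.+-cancelˡ-< i (n ∸ i) b
        (Eq.subst (ℕ._< i ℕ.+ b) (Eq.sym (ℕP.m+[n∸m]≡n i≤n))
          (ℕP.<-≤-trans n<a+b (ℕP.+-monoˡ-≤ b (ℕP.≮⇒≥ i≮a))))

  ^ˢ-orderAtLeast : ∀ {a X} → OrderAtLeast a X → ∀ j → OrderAtLeast (j ℕ.* a) (X ^ˢ j)
  ^ˢ-orderAtLeast ordX zero    n ()
  ^ˢ-orderAtLeast ordX (suc j) = ⊛-orderAtLeast ordX (^ˢ-orderAtLeast ordX j)

  private
    sumList : List Carrier → Carrier
    sumList = foldr _+_ 0#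

  sumList-zipWith-applyDownFrom :
    ∀ n (a b : ℕ → Carrier) {bs} → Pointwise _≈_ bs (applyDownFrom b (suc n)) →
    sumList (zipWith _*_ (applyUpTo a (suc n)) bs) ≈ sumBelow (suc n) (λ m → a m * b (n ∸ m))
  sumList-zipWith-applyDownFrom zero    a b (x≈b0 ∷ []) = trans (+-comm _ _) (+-cong refl (*-cong refl x≈b0))
  sumList-zipWith-applyDownFrom (suc n) a b (x≈bn ∷ bs≈) =
    trans (+-cong (*-cong refl x≈bn) (sumList-zipWith-applyDownFrom n (λ m → a (suc m)) b bs≈))
          (sym (sumBelow-suc (suc n) (λ m → a m * b (suc n ∸ m))))

  module _ (u b : Series) (b0≈1 : b 0 ≈ 1#)
           (b-rec : ∀ n → b (suc n) ≈ - sumBelow (suc n) (λ m → u (suc m) * b (n ∸ m))) where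

    recipList≈applyDownFrom : ∀ n → Pointwise _≈_ (recipList u n) (applyDownFrom b (suc n))
    recipList≈applyDownFrom zero    = sym b0≈1 ∷ []
    recipList≈applyDownFrom (suc n) = trans (-‿cong sumList≈) (sym (b-rec n)) ∷ recipList≈applyDownFrom n
      where
      sumList≈ : sumList (zipWith _*_ (map (λ m → u (suc m)) (upTo (suc n))) (recipList u n))
               ≈ sumBelow (suc n) (λ m → u (suc m) * b (n ∸ m))
      sumList≈ rewrite map-applyUpTo (λ m → m) (λ m → u (suc m)) (suc n) =
        sumList-zipWith-applyDownFrom n (λ m → u (suc m)) b (recipList≈applyDownFrom n)

    recip₁-unique : recip₁ u ≋ b
    recip₁-unique n with recipList u n | recipList≈applyDownFrom n
    ... | _ ∷ _ | bn≈ ∷ _ = bn≈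

  geometric : Series → Series
  geometric P m = sumBelow (suc m) (λ j → (P ^ˢ j) m)

  module _ (P : Series) (P0≈0 : P 0 ≈ 0#) where

    geometric-partial : ∀ {N m} → m ℕ.< N → sumBelow N (λ j → (P ^ˢ j) m) ≈ geometric P m
    geometric-partial {m = m} m<N = sumBelow-truncate (λ j → (P ^ˢ j) m) (ℕP.≤⇒≤′ m<N)
      (λ j m<j → ^ˢ-orderAtLeast ordP j m (ℕP.<-≤-trans m<j (ℕP.≤-reflexive (Eq.sym (ℕP.*-identityʳ j)))))
      where
      ordP : OrderAtLeast 1 P
      ordP zero    _        = P0≈0
      ordP (suc n) (s≤s ())

    geometric-suc : ∀ n → geometric P (suc n) ≈ sumBelow (suc n) (λ m → P (suc m) * geometric P (n ∸ m))
    geometric-suc n = begin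
      geometric P (suc n)
        ≈⟨ sumBelow-suc (suc n) (λ j → (P ^ˢ j) (suc n)) ⟩
      0# + sumBelow (suc n) (λ j → (P ⊛ (P ^ˢ j)) (suc n))
        ≈⟨ trans (+-identityˡ _) (sym (⊛-sumBelowʳ P (P ^ˢ_) (suc n) (suc n))) ⟩
      (P ⊛ G) (suc n)
        ≈⟨ sumBelow-suc (suc n) (λ i → P i * G (suc n ∸ i)) ⟩
      P 0 * G (suc n) + sumBelow (suc n) (λ m → P (suc m) * G (n ∸ m))
        ≈⟨ +-cong (trans (*-cong P0≈0 refl) (zeroˡ _)) refl ⟩
      0# + sumBelow (suc n) (λ m → P (suc m) * G (n ∸ m))
        ≈⟨ +-identityˡ _ ⟩
      sumBelow (suc n) (λ m → P (suc m) * G (n ∸ m))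
        ≈⟨ sumBelow-cong (suc n) (λ m _ → *-cong refl (geometric-partial (s≤s (ℕP.m∸n≤m n m)))) ⟩
      sumBelow (suc n) (λ m → P (suc m) * geometric P (n ∸ m)) ∎
      where
      G : Series
      G k = sumBelow (suc n) (λ j → (P ^ˢ j) k)

    recip₁-oneS⊖ : recip₁ (oneS ⊖ P) ≋ geometric P
    recip₁-oneS⊖ = recip₁-unique (oneS ⊖ P) (geometric P) (+-identityˡ 1#) (λ n → sym (begin
      - sumBelow (suc n) (λ m → (0# - P (suc m)) * geometric P (n ∸ m))
        ≈⟨ -‿cong (sumBelow-cong (suc n) (λ m _ →
             trans (*-cong (+-identityˡ _) refl) (sym (-‿distribˡ-* _ _)))) ⟩
      - sumBelow (suc n) (λ m → - (P (suc m) * geometric P (n ∸ m)))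
        ≈⟨ -‿cong (sym (-‿sumBelow (suc n) _)) ⟩
      - - sumBelow (suc n) (λ m → P (suc m) * geometric P (n ∸ m))
        ≈⟨ -‿involutive _ ⟩
      sumBelow (suc n) (λ m → P (suc m) * geometric P (n ∸ m))
        ≈⟨ sym (geometric-suc n) ⟩
      geometric P (suc n) ∎))

  module RowSums (g f₁ f₂ : Series) where

    entry-pair : ∀ n j → entry g f₁ f₂ n (double j) + entry g f₁ f₂ n (suc (double j))
                         ≈ ((g ⊛ (oneS ⊕ f₁)) ⊛ (xS f₂ ^ˢ j)) n
    entry-pair n j = begin
      entry g f₁ f₂ n (double j) + entry g f₁ f₂ n (suc (double j))
        ≈⟨ +-cong (reflexive (Eq.cong₂ column (double%2 j) (double/2 j)))
                  (reflexive (Eq.cong₂ column (suc-double%2 j) (suc-double/2 j))) ⟩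
      ((g ⊛ oneS) ⊛ (xS f₂ ^ˢ j)) n + ((g ⊛ (f₁ ⊛ oneS)) ⊛ (xS f₂ ^ˢ j)) n
        ≈⟨ sym (⊛-distribʳ (g ⊛ oneS) (g ⊛ (f₁ ⊛ oneS)) (xS f₂ ^ˢ j) n) ⟩
      (((g ⊛ oneS) ⊕ (g ⊛ (f₁ ⊛ oneS))) ⊛ (xS f₂ ^ˢ j)) n
        ≈⟨ ⊛-congˡ (xS f₂ ^ˢ j) factor n ⟩
      ((g ⊛ (oneS ⊕ f₁)) ⊛ (xS f₂ ^ˢ j)) n ∎
      where
      column : ℕ → ℕ → Carrier
      column r q = ((g ⊛ (f₁ ^ˢ r)) ⊛ (xS f₂ ^ˢ q)) n

      factor : ((g ⊛ oneS) ⊕ (g ⊛ (f₁ ⊛ oneS))) ≋ (g ⊛ (oneS ⊕ f₁))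
      factor m = trans (+-cong refl (⊛-congʳ-≤ g m (λ k _ → ⊛-identityʳ f₁ k)))
                       (sym (⊛-distribˡ g oneS f₁ m))

      double%2 : ∀ j → double j % 2 Eq.≡ 0
      double%2 zero    = Eq.refl
      double%2 (suc j) = double%2 j

      suc-double%2 : ∀ j → suc (double j) % 2 Eq.≡ 1
      suc-double%2 zero    = Eq.refl
      suc-double%2 (suc j) = suc-double%2 j

      double/2 : ∀ j → double j / 2 Eq.≡ j
      double/2 zero    = Eq.refl
      double/2 (suc j) = Eq.trans (m/n≡1+[m∸n]/n {double (suc j)} {2} (s≤s (s≤s z≤n))) (Eq.cong suc (double/2 j))

      suc-double/2 : ∀ j → suc (double j) / 2 Eq.≡ j
      suc-double/2 zero    = Eq.refl
      suc-double/2 (suc j) =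
        Eq.trans (m/n≡1+[m∸n]/n {suc (double (suc j))} {2} (s≤s (s≤s z≤n))) (Eq.cong suc (suc-double/2 j))

    module _ (f₁0≈0 : f₁ 0 ≈ 0#) (f₂0≈0 : f₂ 0 ≈ 0#) where

      -- The column k series has order at least (k % 2) · 1 + (k / 2) · 2 = k.
      entry-lowerTriangular : ∀ n k → n ℕ.< k → entry g f₁ f₂ n k ≈ 0#
      entry-lowerTriangular n k n<k =
        ⊛-orderAtLeast (⊛-orderAtLeast {0} (λ _ ()) (^ˢ-orderAtLeast ordf₁ (k % 2)))
                       (^ˢ-orderAtLeast ordxf₂ (k / 2)) n
          (Eq.subst (n ℕ.<_) (Eq.trans (m≡m%n+[m/n]*n k 2)
                               (Eq.cong (ℕ._+ (k / 2) ℕ.* 2) (Eq.sym (ℕP.*-identityʳ (k % 2))))) n<k)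
        where
        ordf₁ : OrderAtLeast 1 f₁
        ordf₁ zero    _        = f₁0≈0
        ordf₁ (suc n) (s≤s ())

        ordxf₂ : OrderAtLeast 2 (xS f₂)
        ordxf₂ zero          _ = refl
        ordxf₂ (suc zero)    _ = f₂0≈0
        ordxf₂ (suc (suc n)) (s≤s (s≤s ()))

      rowSum-geometric : rowSum g f₁ f₂ ≋ ((g ⊛ (oneS ⊕ f₁)) ⊛ geometric (xS f₂))
      rowSum-geometric n = begin
        sumBelow (suc n) (entry g f₁ f₂ n)
          ≈⟨ sym (sumBelow-truncate (entry g f₁ f₂ n) (ℕP.≤⇒≤′ (n≤double (suc n)))
                   (entry-lowerTriangular n)) ⟩
        sumBelow (double (suc n)) (entry g f₁ f₂ n)
          ≈⟨ sumBelow-pairs (suc n) (entry g f₁ f₂ n) ⟩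
        sumBelow (suc n) (λ j → entry g f₁ f₂ n (double j) + entry g f₁ f₂ n (suc (double j)))
          ≈⟨ sumBelow-cong (suc n) (λ j _ → entry-pair n j) ⟩
        sumBelow (suc n) (λ j → ((g ⊛ (oneS ⊕ f₁)) ⊛ (xS f₂ ^ˢ j)) n)
          ≈⟨ sym (⊛-sumBelowʳ (g ⊛ (oneS ⊕ f₁)) (xS f₂ ^ˢ_) (suc n) n) ⟩
        ((g ⊛ (oneS ⊕ f₁)) ⊛ (λ m → sumBelow (suc n) (λ j → (xS f₂ ^ˢ j) m))) n
          ≈⟨ ⊛-congʳ-≤ (g ⊛ (oneS ⊕ f₁)) n (λ m m≤n → geometric-partial (xS f₂) refl (s≤s m≤n)) ⟩
        ((g ⊛ (oneS ⊕ f₁)) ⊛ geometric (xS f₂)) n ∎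

-- Only the vanishing constant terms of f₁ and f₂ are used: the identity holds
-- over any commutative ring.
mainTheorem18 : {c ℓ : Level} (K : CommutativeRing c ℓ) →
    let open PS K in
    IsField → CharZero →
    (g f₁ f₂ : Series) → IsSprugnoliArray g f₁ f₂ →
    rowSum g f₁ f₂ ≋ ((g ⊛ (oneS ⊕ f₁)) ⊛ recip₁ (oneS ⊖ xS f₂))
mainTheorem18 K _ _ g f₁ f₂ (_ , (f₁<1≈0 , _) , (f₂<1≈0 , _) , _) n =
  trans (rowSum-geometric (f₁<1≈0 0 (s≤s z≤n)) (f₂<1≈0 0 (s≤s z≤n)) n)
        (⊛-congʳ-≤ (g ⊛ (oneS ⊕ f₁)) n (λ m _ → sym (recip₁-oneS⊖ (xS f₂) refl m)))
  where
  open CommutativeRing K using (trans; sym; refl)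
  open PS K
  open SeriesAlgebra K
  open RowSums g f₁ f₂
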